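{- Let $p$ be an odd prime and let $\mathcal{C}_{2p}=\operatorname{conv}(\pm e_1,\dots,\pm e_{p-1},\pm\mathbf{1})\subset\mathbb{R}^{p-1}$, where $\mathbf{1}=e_1+\cdots+e_{p-1}$. For every integer $k$ with $k\le\frac{p-1}{2}$ (and $k\ge1$), the number of $(k-1)$-dimensional faces of $\mathcal{C}_{2p}$ is \[ f_{k-1}=2^k\binom{p}{k}. \]
   Context: $\mathcal{C}_{2p}$ is the cyclotomic polytope of $\mathbb{Z}[\zeta_{2p}]$, i.e. $\mathcal{C}_2\otimes\mathcal{C}_p$ with $\mathcal{C}_2=\operatorname{conv}(1,-1)\subset\mathbb{R}$ and $\mathcal{C}_p=\operatorname{conv}(e_1,\dots,e_{p-1},-\mathbf{1})$.
   Formalization: The polytope $\mathcal{C}_{2p}$ lies in ℚ^(p-1) instead of $\mathbb{R}^{p-1}$, with its faces exposed by rational linear functionals and affine independence of vertices taken over ℚ. -}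

module Defs where

open import Data.Nat as ℕ using (ℕ; zero; suc; _∸_)
open import Data.Bool using (Bool; true; false; if_then_else_; _∨_)
open import Data.Fin as Fin using (Fin; toℕ; splitAt)
open import Data.Fin.Subset using (Subset; _∈_)
open import Data.Sum using (_⊎_; inj₁; inj₂)
open import Data.Product using (Σ; ∃; _×_; _,_)
open import Data.Rational using (ℚ; 0ℚ; 1ℚ; _+_; _*_; -_; _≤_)
open import Relation.Binary.PropositionalEquality using (_≡_)
open import Relation.Nullary using (¬_)
open import Function.Definitions using (Injective)
open import Function.Bundles using (_⇔_)

Σℚ : (m : ℕ) → (Fin m → ℚ) → ℚ
Σℚ zero    f = 0ℚ
Σℚ (suc m) f = f Fin.zero + Σℚ m (λ i → f (Fin.suc i))

Pt : ℕ → Set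
Pt n = Fin n → ℚ

_·_ : {n : ℕ} → Pt n → Pt n → ℚ
_·_ {n} x y = Σℚ n (λ i → x i * y i)

dimC : ℕ → ℕ
dimC p = p ∸ 1

-- u p j = e_j for j < p-1, and u p (p-1) = 𝟏 = e_1 + ... + e_{p-1}.
u : (p : ℕ) → Fin p → Pt (dimC p)
u p j i = if (toℕ j ℕ.≡ᵇ toℕ i) ∨ (toℕ j ℕ.≡ᵇ dimC p) then 1ℚ else 0ℚ

vert : (p : ℕ) → Fin (p ℕ.+ p) → Pt (dimC p)
vert p i with splitAt p i
... | inj₁ j = u p j
... | inj₂ j = λ c → - (u p j c)

IsFace : (p : ℕ) → Subset (p ℕ.+ p) → Set
IsFace p F = Σ (Pt (dimC p)) λ c → Σ ℚ λ b →
  (∀ i → (c · vert p i) ≤ b) × (∀ i → ((c · vert p i) ≡ b) ⇔ (i ∈ F))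

AffIndep : {n : ℕ} (m : ℕ) → (Fin m → Pt n) → Set
AffIndep {n} m x = (a : Fin m → ℚ) →
  Σℚ m a ≡ 0ℚ → (∀ c → Σℚ m (λ j → a j * x j c) ≡ 0ℚ) → ∀ j → a j ≡ 0ℚ

HasAffDim : (p : ℕ) → Subset (p ℕ.+ p) → ℕ → Set
HasAffDim p F d =
  (Σ (Fin (suc d) → Fin (p ℕ.+ p)) λ s → (∀ j → s j ∈ F) × AffIndep (suc d) (λ j → vert p (s j)))
  × ((s : Fin (suc (suc d)) → Fin (p ℕ.+ p)) → (∀ j → s j ∈ F) →
       ¬ AffIndep (suc (suc d)) (λ j → vert p (s j)))

CountIs : {m : ℕ} → (Subset m → Set) → ℕ → Set
CountIs {m} P N = Σ (Fin N → Subset m) λ g →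
  Injective _≡_ _≡_ g × (∀ F → P F ⇔ (∃ λ j → g j ≡ F))

IsFaceOfDim : (p : ℕ) → ℕ → Subset (p ℕ.+ p) → Set
IsFaceOfDim p d F = IsFace p F × HasAffDim p F d

module Submission where

-- The vertices of 𝒞_{2p} are ±u_j (j < p), where u_j = e_j for j < p - 1 and
-- u_{p-1} = 𝟏 = Σ_{j<p-1} u_j is their only linear relation. A sign vector
-- σ ∈ {+,-,0}^p describes the vertex set {σ_j u_j : σ_j ≠ 0}.
-- If 2·weight(σ) < p, the functional with value Z·σ_j on u_j (Z the number of zeros
-- of σ), the correction forced by the relation being spread over the zeros of σ,
-- exposes exactly this set; as some σ_r = 0 its vertices are linearly independent,
-- so it is a face of dimension weight(σ) - 1.
-- Conversely, a face of dimension d with d + 2 ≤ p - 1 is not at level 0 (it would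
-- contain d + 2 independent e_j), so it meets each pair ±u_j at most once and equals
-- {σ_j u_j} for the signs σ_j of the exposing functional on the u_j. Not every σ_j
-- is nonzero: the relation would write σ_{p-1} = ±1 as a sum of the even number
-- p - 1 of signs. So the (k-1)-faces correspond to the 2^k·C(p,k) sign vectors of
-- weight k.

open import Data.Nat.Base using (ℕ)

module Rationals where
  open import Algebra.Bundles using (CommutativeRing)
  open import Data.Empty using (⊥-elim)
  open import Data.Fin.Base using (Fin; zero; suc)
  open import Data.Fin.Properties using (suc-injective)
  open import Data.Nat.Base as ℕ using (ℕ; zero; suc; s≤s)
  import Data.Nat.Properties as ℕ
  open import Data.Rational.Base
  open import Data.Rational.Properties
  open import Data.Rational.Solver public using (module +-*-Solver)
  open import Data.Sum.Base using (inj₁; inj₂)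
  open import Function.Base using (_∘_)
  open import Relation.Binary.Definitions using (tri<; tri≈; tri>)
  open import Relation.Binary.PropositionalEquality
  open import Defs using (Σℚ)

  open CommutativeRing +-*-commutativeRing using (semiring)
  open import Algebra.Properties.Semiring.Sum semiring public
    using (sum; sum-cong-≗; ∑-distrib-+; *-distribˡ-sum; *-distribʳ-sum; sum-init-last;
           sum-replicate; sum-replicate-zero)
  open import Algebra.Properties.Monoid.Mult +-0-monoid using (_×_; ×-homo-+)
  open import Algebra.Properties.Ring +-*-ring public using (-‿involutive)

  Σℚ≡sum : ∀ m (f : Fin m → ℚ) → Σℚ m f ≡ sum f
  Σℚ≡sum zero    f = refl
  Σℚ≡sum (suc m) f = cong (f zero +_) (Σℚ≡sum m (λ i → f (suc i)))

  sum-neg : ∀ {m} (f : Fin m → ℚ) → sum (λ i → - f i) ≡ - sum f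
  sum-neg {zero}  f = refl
  sum-neg {suc m} f = trans (cong (- f zero +_) (sum-neg (λ i → f (suc i))))
                            (sym (neg-distrib-+ (f zero) _))

  sum-mono-≤ : ∀ {m} {f g : Fin m → ℚ} → (∀ i → f i ≤ g i) → sum f ≤ sum g
  sum-mono-≤ {zero}  f≤g = ≤-refl
  sum-mono-≤ {suc m} f≤g = +-mono-≤ (f≤g zero) (sum-mono-≤ (λ i → f≤g (suc i)))

  sum-concentrated : ∀ {m} (f : Fin m → ℚ) (a : Fin m) → (∀ j → j ≢ a → f j ≡ 0ℚ) → sum f ≡ f a
  sum-concentrated {suc m} f zero    f≡0 = begin
    f zero + sum (λ i → f (suc i)) ≡⟨ cong (f zero +_) rest≡0 ⟩
    f zero + 0ℚ                    ≡⟨ +-identityʳ (f zero) ⟩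
    f zero                         ∎
    where
    open ≡-Reasoning
    rest≡0 : sum (λ i → f (suc i)) ≡ 0ℚ
    rest≡0 = trans (sum-cong-≗ (λ i → f≡0 (suc i) λ ())) (sum-replicate-zero m)
  sum-concentrated {suc m} f (suc a) f≡0 = begin
    f zero + sum (λ i → f (suc i)) ≡⟨ cong (_+ sum (λ i → f (suc i))) (f≡0 zero λ ()) ⟩
    0ℚ + sum (λ i → f (suc i))     ≡⟨ +-identityˡ _ ⟩
    sum (λ i → f (suc i))          ≡⟨ sum-concentrated (λ i → f (suc i)) a
                                                         (λ j j≢a → f≡0 (suc j) (j≢a ∘ suc-injective)) ⟩
    f (suc a)                      ∎
    where open ≡-Reasoning

  toℚ : ℕ → ℚ
  toℚ m = m × 1ℚ

  toℚ-+ : ∀ m n → toℚ (m ℕ.+ n) ≡ toℚ m + toℚ n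
  toℚ-+ m n = ×-homo-+ 1ℚ m n

  toℚ-<-suc : ∀ m → toℚ m < toℚ (suc m)
  toℚ-<-suc m = subst (_< 1ℚ + toℚ m) (+-identityˡ (toℚ m)) (+-monoˡ-< (toℚ m) (positive⁻¹ 1ℚ))

  toℚ-mono-< : ∀ {m n} → m ℕ.< n → toℚ m < toℚ n
  toℚ-mono-< {m} {suc n} (s≤s m≤n) with ℕ.m≤n⇒m<n∨m≡n m≤n
  ... | inj₁ m<n  = <-trans (toℚ-mono-< m<n) (toℚ-<-suc n)
  ... | inj₂ refl = toℚ-<-suc m

  toℚ-mono-≤ : ∀ {m n} → m ℕ.≤ n → toℚ m ≤ toℚ n
  toℚ-mono-≤ m≤n with ℕ.m≤n⇒m<n∨m≡n m≤n
  ... | inj₁ m<n  = <⇒≤ (toℚ-mono-< m<n)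
  ... | inj₂ refl = ≤-refl

  toℚ-injective : ∀ {m n} → toℚ m ≡ toℚ n → m ≡ n
  toℚ-injective {m} {n} eq with ℕ.<-cmp m n
  ... | tri< m<n _ _ = ⊥-elim (<⇒≢ (toℚ-mono-< m<n) eq)
  ... | tri≈ _ m≡n _ = m≡n
  ... | tri> _ _ n<m = ⊥-elim (<⇒≢ (toℚ-mono-< n<m) (sym eq))

  *-cancelʳ-≡ : ∀ p q r .{{_ : NonZero r}} → p * r ≡ q * r → p ≡ q
  *-cancelʳ-≡ p q r eq = begin
    p                ≡⟨ cancel p ⟩
    p * r * 1/ r     ≡⟨ cong (_* 1/ r) eq ⟩
    q * r * 1/ r     ≡⟨ sym (cancel q) ⟩
    q                ∎
    where
    open ≡-Reasoning
    cancel : ∀ x → x ≡ x * r * 1/ r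
    cancel x = sym (trans (*-assoc x r (1/ r)) (trans (cong (x *_) (*-inverseʳ r)) (*-identityʳ x)))

  +-cancelʳ-< : ∀ p q r → p + r < q + r → p < q
  +-cancelʳ-< p q r lt = subst₂ _<_ (cancel p) (cancel q) (+-monoˡ-< (- r) lt)
    where
    cancel : ∀ x → x + r + - r ≡ x
    cancel x = trans (+-assoc x r (- r)) (trans (cong (x +_) (+-inverseʳ r)) (+-identityʳ x))

  ≤∧≢⇒< : ∀ {x y} → x ≤ y → x ≢ y → x < y
  ≤∧≢⇒< {x} {y} x≤y x≢y with <-cmp x y
  ... | tri< x<y _ _ = x<y
  ... | tri≈ _ x≡y _ = ⊥-elim (x≢y x≡y)
  ... | tri> _ _ y<x = ⊥-elim (<-irrefl refl (<-≤-trans y<x x≤y))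

  neg-<-pos : ∀ {b} → 0ℚ < b → - b < b
  neg-<-pos 0<b = <-trans (neg-antimono-< 0<b) 0<b

  nonneg-bound : ∀ {x b} → x ≤ b → - x ≤ b → 0ℚ ≤ b
  nonneg-bound {x} {b} x≤b -x≤b = ≮⇒≥ b≮0
    where
    b≮0 : b ≮ 0ℚ
    b≮0 b<0 = <-asym (<-≤-trans (neg-antimono-< (≤-<-trans x≤b b<0)) -x≤b) b<0

module SignVectors where
  open import Data.Fin.Base using (Fin; zero; suc)
  open import Data.Fin.Properties using (suc-injective)
  open import Data.Nat.Base as ℕ using (ℕ; zero; suc; z≤n; s≤s)
  import Data.Nat.Properties as ℕ
  open import Data.Product.Base using (Σ; ∃; _×_; _,_)
  open import Data.Rational.Base using (ℚ; 0ℚ; 1ℚ; _+_; _*_; -_; _≤_; _<_)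
  open import Data.Rational.Properties
    using (_≟_; ≤-refl; <⇒≤; <⇒≢; positive⁻¹; +-identityˡ; +-assoc; *-identityˡ; +-*-ring)
  open import Algebra.Properties.Ring +-*-ring using (-1*x≈-x)
  open import Data.Vec.Base using (Vec; []; _∷_; lookup)
  open import Function.Base using (_∘_; const)
  open import Function.Bundles using (_⇔_; mk⇔)
  open import Relation.Binary.PropositionalEquality
  open import Relation.Nullary.Decidable.Core using (yes; no)
  open import Relation.Nullary.Negation using (¬_; contradiction)
  open Rationals
  open +-*-Solver using (solve; con; _:+_; _:*_; :-_; _:=_)

  data Sign : Set where
    pos neg off : Sign

  weight : ∀ {m} → Vec Sign m → ℕ
  weight []        = 0
  weight (pos ∷ σ) = suc (weight σ)
  weight (neg ∷ σ) = suc (weight σ)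
  weight (off ∷ σ) = weight σ

  weight≤length : ∀ {m} (σ : Vec Sign m) → weight σ ℕ.≤ m
  weight≤length []        = z≤n
  weight≤length (pos ∷ σ) = s≤s (weight≤length σ)
  weight≤length (neg ∷ σ) = s≤s (weight≤length σ)
  weight≤length (off ∷ σ) = ℕ.m≤n⇒m≤1+n (weight≤length σ)

  off⇒weight< : ∀ {m} (σ : Vec Sign m) j → lookup σ j ≡ off → weight σ ℕ.< m
  off⇒weight< (off ∷ σ) zero    _  = s≤s (weight≤length σ)
  off⇒weight< (pos ∷ σ) (suc j) eq = s≤s (off⇒weight< σ j eq)
  off⇒weight< (neg ∷ σ) (suc j) eq = s≤s (off⇒weight< σ j eq)
  off⇒weight< (off ∷ σ) (suc j) eq = ℕ.m≤n⇒m≤1+n (off⇒weight< σ j eq)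

  weight<⇒off : ∀ {m} (σ : Vec Sign m) → weight σ ℕ.< m → ∃ λ j → lookup σ j ≡ off
  weight<⇒off (off ∷ σ) _         = zero , refl
  weight<⇒off (pos ∷ σ) (s≤s w<m) with weight<⇒off σ w<m
  ... | j , eq = suc j , eq
  weight<⇒off (neg ∷ σ) (s≤s w<m) with weight<⇒off σ w<m
  ... | j , eq = suc j , eq

  support : ∀ {m} (σ : Vec Sign m) → Fin (weight σ) → Fin m
  support (pos ∷ σ) zero    = zero
  support (pos ∷ σ) (suc r) = suc (support σ r)
  support (neg ∷ σ) zero    = zero
  support (neg ∷ σ) (suc r) = suc (support σ r)
  support (off ∷ σ) r       = suc (support σ r)

  support-injective : ∀ {m} (σ : Vec Sign m) {r r′} → support σ r ≡ support σ r′ → r ≡ r′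
  support-injective (pos ∷ σ) {zero}  {zero}   _  = refl
  support-injective (pos ∷ σ) {suc r} {suc r′} eq = cong suc (support-injective σ (suc-injective eq))
  support-injective (neg ∷ σ) {zero}  {zero}   _  = refl
  support-injective (neg ∷ σ) {suc r} {suc r′} eq = cong suc (support-injective σ (suc-injective eq))
  support-injective (off ∷ σ)                  eq = support-injective σ (suc-injective eq)

  support-nonzero : ∀ {m} (σ : Vec Sign m) r → lookup σ (support σ r) ≢ off
  support-nonzero (pos ∷ σ) zero    ()
  support-nonzero (pos ∷ σ) (suc r) = support-nonzero σ r
  support-nonzero (neg ∷ σ) zero    ()
  support-nonzero (neg ∷ σ) (suc r) = support-nonzero σ r
  support-nonzero (off ∷ σ) r       = support-nonzero σ r

  rank : ∀ {m} (σ : Vec Sign m) j → lookup σ j ≢ off → Fin (weight σ)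
  rank (pos ∷ σ) zero    _  = zero
  rank (pos ∷ σ) (suc j) σj = suc (rank σ j σj)
  rank (neg ∷ σ) zero    _  = zero
  rank (neg ∷ σ) (suc j) σj = suc (rank σ j σj)
  rank (off ∷ σ) zero    σj = contradiction refl σj
  rank (off ∷ σ) (suc j) σj = rank σ j σj

  support-rank : ∀ {m} (σ : Vec Sign m) j (σj : lookup σ j ≢ off) → support σ (rank σ j σj) ≡ j
  support-rank (pos ∷ σ) zero    _  = refl
  support-rank (pos ∷ σ) (suc j) σj = cong suc (support-rank σ j σj)
  support-rank (neg ∷ σ) zero    _  = refl
  support-rank (neg ∷ σ) (suc j) σj = cong suc (support-rank σ j σj)
  support-rank (off ∷ σ) zero    σj = contradiction refl σj
  support-rank (off ∷ σ) (suc j) σj = cong suc (support-rank σ j σj)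

  ⟦_⟧ : Sign → ℚ
  ⟦ pos ⟧ = 1ℚ
  ⟦ neg ⟧ = - 1ℚ
  ⟦ off ⟧ = 0ℚ

  ∣_∣ˢ : Sign → ℚ
  ∣ off ∣ˢ = 0ℚ
  ∣ _   ∣ˢ = 1ℚ

  [_≡off] : Sign → ℚ
  [ off ≡off] = 1ℚ
  [ _   ≡off] = 0ℚ

  ⟦⟧≤∣∣ˢ : ∀ s → ⟦ s ⟧ ≤ ∣ s ∣ˢ
  ⟦⟧≤∣∣ˢ pos = ≤-refl
  ⟦⟧≤∣∣ˢ neg = <⇒≤ (neg-<-pos (positive⁻¹ 1ℚ))
  ⟦⟧≤∣∣ˢ off = ≤-refl

  -⟦⟧≤∣∣ˢ : ∀ s → - ⟦ s ⟧ ≤ ∣ s ∣ˢ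
  -⟦⟧≤∣∣ˢ pos = <⇒≤ (neg-<-pos (positive⁻¹ 1ℚ))
  -⟦⟧≤∣∣ˢ neg = ≤-refl
  -⟦⟧≤∣∣ˢ off = ≤-refl

  sum-∣∣ˢ : ∀ {m} (σ : Vec Sign m) → sum (∣_∣ˢ ∘ lookup σ) ≡ toℚ (weight σ)
  sum-∣∣ˢ []        = refl
  sum-∣∣ˢ (pos ∷ σ) = cong (1ℚ +_) (sum-∣∣ˢ σ)
  sum-∣∣ˢ (neg ∷ σ) = cong (1ℚ +_) (sum-∣∣ˢ σ)
  sum-∣∣ˢ (off ∷ σ) = trans (+-identityˡ _) (sum-∣∣ˢ σ)

  sum-[≡off]+weight : ∀ {m} (σ : Vec Sign m) → sum ([_≡off] ∘ lookup σ) + toℚ (weight σ) ≡ toℚ m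
  sum-[≡off]+weight {m} σ = begin
    sum zeros + toℚ (weight σ)                       ≡⟨ cong (sum zeros +_) (sym (sum-∣∣ˢ σ)) ⟩
    sum zeros + sum (∣_∣ˢ ∘ lookup σ)                ≡⟨ sym (∑-distrib-+ zeros (∣_∣ˢ ∘ lookup σ)) ⟩
    sum (λ j → [ lookup σ j ≡off] + ∣ lookup σ j ∣ˢ) ≡⟨ sum-cong-≗ (partition ∘ lookup σ) ⟩
    sum {m} (λ _ → 1ℚ)                               ≡⟨ sum-replicate m ⟩
    toℚ m                                            ∎
    where
    open ≡-Reasoning
    zeros : Fin m → ℚ
    zeros = [_≡off] ∘ lookup σ
    partition : ∀ s → [ s ≡off] + ∣ s ∣ˢ ≡ 1ℚ
    partition pos = refl
    partition neg = refl
    partition off = refl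

  -- For x = c · u_j: the vertex selected by s (none for off) among ±u_j is on the
  -- level b of the functional c, the other ones lie strictly below it.
  Fits : ℚ → Sign → ℚ → Set
  Fits b pos x = x ≡ b
  Fits b neg x = - x ≡ b
  Fits b off x = x < b × - x < b

  private
    at-level : ∀ {x b} {A : Set} → x ≡ b → A → x ≤ b × (x ≡ b ⇔ A)
    at-level refl a = ≤-refl , mk⇔ (const a) (const refl)

    below-level : ∀ {x b} {A : Set} → x < b → ¬ A → x ≤ b × (x ≡ b ⇔ A)
    below-level x<b ¬a = <⇒≤ x<b , mk⇔ (λ x≡b → contradiction x≡b (<⇒≢ x<b)) (λ a → contradiction a ¬a)

  fits-level : ∀ {b x} s → 0ℚ < b → Fits b s x →
               (x ≤ b × (x ≡ b ⇔ s ≡ pos)) × (- x ≤ b × (- x ≡ b ⇔ s ≡ neg))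
  fits-level pos 0<b refl            = at-level refl refl , below-level (neg-<-pos 0<b) (λ ())
  fits-level {b} {x} neg 0<b -x≡b    = below-level x<b (λ ()) , at-level -x≡b refl
    where
    x<b : x < b
    x<b = subst (_< b) (trans (cong -_ (sym -x≡b)) (-‿involutive x)) (neg-<-pos 0<b)
  fits-level off 0<b (x<b , -x<b)    = below-level x<b (λ ()) , below-level -x<b (λ ())

  fitting-sign : ∀ {x b} → x ≤ b → - x ≤ b → Σ Sign λ s → Fits b s x
  fitting-sign {x} {b} x≤b -x≤b with x ≟ b | - x ≟ b
  ... | yes x≡b | _         = pos , x≡b
  ... | no _    | yes -x≡b  = neg , -x≡b
  ... | no x≢b  | no -x≢b   = off , ≤∧≢⇒< x≤b x≢b , ≤∧≢⇒< -x≤b -x≢b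

  fits-value : ∀ {b x} s → Fits b s x → s ≢ off → x ≡ ⟦ s ⟧ * b
  fits-value pos x≡b  _  = trans x≡b (sym (*-identityˡ _))
  fits-value {b} {x} neg -x≡b _ = begin
    x          ≡⟨ sym (-‿involutive x) ⟩
    - (- x)    ≡⟨ cong -_ -x≡b ⟩
    - b        ≡⟨ sym (-1*x≈-x b) ⟩
    - 1ℚ * b   ∎
    where open ≡-Reasoning
  fits-value off _    s≢off = contradiction refl s≢off

  fits-perturbed : ∀ {b w} → w < b → - w < b → ∀ s → Fits b s (b * ⟦ s ⟧ + w * [ s ≡off])
  fits-perturbed {b} {w} w<b -w<b pos = solve 2 (λ b w → b :* con 1ℚ :+ w :* con 0ℚ := b) refl b w
  fits-perturbed {b} {w} w<b -w<b neg =
    solve 2 (λ b w → :- (b :* :- con 1ℚ :+ w :* con 0ℚ) := b) refl b w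
  fits-perturbed {b} {w} w<b -w<b off = subst (λ y → y < b × - y < b) (sym (value b w)) (w<b , -w<b)
    where
    value : ∀ b w → b * 0ℚ + w * 1ℚ ≡ w
    value = solve 2 (λ b w → b :* con 0ℚ :+ w :* con 1ℚ := w) refl

  sum-signs-parity : ∀ {m} (σ : Vec Sign m) → (∀ j → lookup σ j ≢ off) →
                     ∃ λ q → sum (⟦_⟧ ∘ lookup σ) + (toℚ q + toℚ q) ≡ toℚ m
  sum-signs-parity []        _       = 0 , refl
  sum-signs-parity (pos ∷ σ) nonzero with sum-signs-parity σ (nonzero ∘ suc)
  ... | q , eq = q , trans (+-assoc 1ℚ (sum (⟦_⟧ ∘ lookup σ)) _) (cong (1ℚ +_) eq)
  sum-signs-parity (neg ∷ σ) nonzero with sum-signs-parity σ (nonzero ∘ suc)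
  ... | q , eq = suc q , trans (regroup (sum (⟦_⟧ ∘ lookup σ)) (toℚ q)) (cong (1ℚ +_) eq)
    where
    regroup : ∀ S Q → - 1ℚ + S + ((1ℚ + Q) + (1ℚ + Q)) ≡ 1ℚ + (S + (Q + Q))
    regroup = solve 2 (λ S Q → :- con 1ℚ :+ S :+ ((con 1ℚ :+ Q) :+ (con 1ℚ :+ Q))
                               := con 1ℚ :+ (S :+ (Q :+ Q))) refl
  sum-signs-parity (off ∷ σ) nonzero = contradiction refl (nonzero zero)

  private
    m+m≢1+n+n : ∀ m n → m ℕ.+ m ≢ suc (n ℕ.+ n)
    m+m≢1+n+n m n eq = ℕ.even≢odd m n (trans (double m) (trans eq (cong suc (sym (double n)))))
      where
      double : ∀ x → 2 ℕ.* x ≡ x ℕ.+ x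
      double x = cong (x ℕ.+_) (ℕ.+-identityʳ x)

  sign+even≢even : ∀ s q h → s ≢ off → ⟦ s ⟧ + (toℚ q + toℚ q) ≢ toℚ h + toℚ h
  sign+even≢even pos q h _ eq = m+m≢1+n+n h q (toℚ-injective (begin
    toℚ (h ℕ.+ h)        ≡⟨ toℚ-+ h h ⟩
    toℚ h + toℚ h        ≡⟨ sym eq ⟩
    1ℚ + (toℚ q + toℚ q) ≡⟨ cong (1ℚ +_) (sym (toℚ-+ q q)) ⟩
    toℚ (suc (q ℕ.+ q))  ∎))
    where open ≡-Reasoning
  sign+even≢even neg q h _ eq = m+m≢1+n+n q h (toℚ-injective (begin
    toℚ (q ℕ.+ q)                 ≡⟨ toℚ-+ q q ⟩
    toℚ q + toℚ q                 ≡⟨ shift (toℚ q + toℚ q) ⟩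
    1ℚ + (- 1ℚ + (toℚ q + toℚ q)) ≡⟨ cong (1ℚ +_) eq ⟩
    1ℚ + (toℚ h + toℚ h)          ≡⟨ cong (1ℚ +_) (sym (toℚ-+ h h)) ⟩
    toℚ (suc (h ℕ.+ h))           ∎))
    where
    open ≡-Reasoning
    shift : ∀ x → x ≡ 1ℚ + (- 1ℚ + x)
    shift = solve 1 (λ x → x := con 1ℚ :+ (:- con 1ℚ :+ x)) refl
  sign+even≢even off q h off≢off = contradiction refl off≢off

module Enumerations where
  open import Data.Empty using (⊥; ⊥-elim)
  open import Data.Fin.Base using (Fin; zero; splitAt; _↑ˡ_; _↑ʳ_; join)
  open import Data.Fin.Properties using (splitAt-↑ˡ; splitAt-↑ʳ; join-splitAt)
  open import Data.Nat.Base using (ℕ; zero; suc; _+_; _*_; _^_)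
  open import Data.Nat.Properties using (*-zeroʳ; suc-injective)
  open import Data.Nat.Combinatorics using (_C_; nCk+nC[k+1]≡[n+1]C[k+1])
  open import Data.Nat.Tactic.RingSolver using (solve-∀)
  open import Data.Product.Base using (Σ; ∃; _×_; _,_)
  open import Data.Sum.Base using (_⊎_; inj₁; inj₂; [_,_]′)
  open import Data.Vec.Base using (Vec; []; _∷_)
  open import Data.Vec.Properties using (∷-injectiveˡ; ∷-injectiveʳ)
  open import Function.Base using (_∘_)
  open import Function.Bundles using (_⇔_; mk⇔; Equivalence)
  open import Function.Definitions using (Injective)
  open import Relation.Binary.PropositionalEquality
  open import Relation.Nullary.Negation using (¬_)
  open SignVectors

  Enumerates : {A : Set} → (A → Set) → ℕ → Set
  Enumerates {A} P N =
    Σ (Fin N → A) λ g → Injective _≡_ _≡_ g × (∀ x → P x ⇔ ∃ λ i → g i ≡ x)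

  module _ {A : Set} where

    enumerates-cong : ∀ {P Q : A → Set} {N} → (∀ x → P x ⇔ Q x) → Enumerates P N → Enumerates Q N
    enumerates-cong P⇔Q (g , g-injective , g-exact) = g , g-injective , λ x → mk⇔
      (Equivalence.to (g-exact x) ∘ Equivalence.from (P⇔Q x))
      (Equivalence.to (P⇔Q x) ∘ Equivalence.from (g-exact x))

    enumerates-image : ∀ {B : Set} {P : A → Set} {N} (f : A → B) → Injective _≡_ _≡_ f →
                       Enumerates P N → Enumerates (λ y → ∃ λ x → P x × f x ≡ y) N
    enumerates-image {P = P} f f-injective (g , g-injective , g-exact) =
      f ∘ g , g-injective ∘ f-injective , λ y → mk⇔ to from
      where
      to : ∀ {y} → (∃ λ x → P x × f x ≡ y) → ∃ λ i → f (g i) ≡ y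
      to (x , Px , fx≡y) with Equivalence.to (g-exact x) Px
      ... | i , gi≡x = i , trans (cong f gi≡x) fx≡y
      from : ∀ {y} → (∃ λ i → f (g i) ≡ y) → ∃ λ x → P x × f x ≡ y
      from (i , fgi≡y) = g i , Equivalence.from (g-exact (g i)) (i , refl) , fgi≡y

    enumerates-⊎ : ∀ {P Q : A → Set} {M N} → (∀ x → P x → Q x → ⊥) →
                   Enumerates P M → Enumerates Q N → Enumerates (λ x → P x ⊎ Q x) (M + N)
    enumerates-⊎ {P} {Q} {M} {N} disjoint (g , g-injective , g-exact) (h , h-injective , h-exact) =
      [ g , h ]′ ∘ splitAt M , injective , λ x → mk⇔ to from
      where
      P-image : ∀ i → P (g i)
      P-image i = Equivalence.from (g-exact (g i)) (i , refl)
      Q-image : ∀ i → Q (h i)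
      Q-image i = Equivalence.from (h-exact (h i)) (i , refl)
      [g,h]-injective : ∀ {u v} → [ g , h ]′ u ≡ [ g , h ]′ v → u ≡ v
      [g,h]-injective {inj₁ i} {inj₁ j} eq = cong inj₁ (g-injective eq)
      [g,h]-injective {inj₁ i} {inj₂ j} eq = ⊥-elim (disjoint _ (P-image i) (subst Q (sym eq) (Q-image j)))
      [g,h]-injective {inj₂ i} {inj₁ j} eq = ⊥-elim (disjoint _ (P-image j) (subst Q eq (Q-image i)))
      [g,h]-injective {inj₂ i} {inj₂ j} eq = cong inj₂ (h-injective eq)
      injective : Injective _≡_ _≡_ ([ g , h ]′ ∘ splitAt M)
      injective {i} {j} eq =
        trans (sym (join-splitAt M N i))
              (trans (cong (join M N) ([g,h]-injective {splitAt M i} {splitAt M j} eq)) (join-splitAt M N j))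
      to : ∀ {x} → P x ⊎ Q x → ∃ λ i → [ g , h ]′ (splitAt M i) ≡ x
      to (inj₁ Px) with Equivalence.to (g-exact _) Px
      ... | i , gi≡x = i ↑ˡ N , trans (cong [ g , h ]′ (splitAt-↑ˡ M i N)) gi≡x
      to (inj₂ Qx) with Equivalence.to (h-exact _) Qx
      ... | i , hi≡x = M ↑ʳ i , trans (cong [ g , h ]′ (splitAt-↑ʳ M N i)) hi≡x
      from : ∀ {x} → (∃ λ i → [ g , h ]′ (splitAt M i) ≡ x) → P x ⊎ Q x
      from (i , eq) with splitAt M i
      ... | inj₁ j = inj₁ (subst P eq (P-image j))
      ... | inj₂ j = inj₂ (subst Q eq (Q-image j))

    enumerates-none : ∀ {P : A → Set} → (∀ x → ¬ P x) → Enumerates P 0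
    enumerates-none ¬P = (λ ()) , (λ { {()} }) , λ x → mk⇔ (⊥-elim ∘ ¬P x) (λ { (() , _) })

    enumerates-single : ∀ {P : A → Set} a → (∀ x → P x ⇔ x ≡ a) → Enumerates P 1
    enumerates-single a P⇔≡a = (λ _ → a) , (λ { {zero} {zero} _ → refl }) , λ x → mk⇔
      (λ Px → zero , sym (Equivalence.to (P⇔≡a x) Px))
      (λ { (zero , a≡x) → Equivalence.from (P⇔≡a x) (sym a≡x) })

  signVectors-of-weight : ∀ m k → Enumerates (λ (σ : Vec Sign m) → weight σ ≡ k) (2 ^ k * (m C k))
  signVectors-of-weight zero    zero    = enumerates-single [] λ { [] → mk⇔ (λ _ → refl) (λ _ → refl) }
  signVectors-of-weight zero    (suc k) =
    subst (Enumerates _) (sym (*-zeroʳ (2 ^ suc k))) (enumerates-none λ { [] () })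
  signVectors-of-weight (suc m) zero    =
    enumerates-cong cons-off (enumerates-image (off ∷_) ∷-injectiveʳ (signVectors-of-weight m zero))
    where
    cons-off : ∀ x → (∃ λ σ → weight σ ≡ 0 × off ∷ σ ≡ x) ⇔ weight x ≡ 0
    cons-off (s ∷ σ) = mk⇔ (λ { (_ , w≡0 , refl) → w≡0 }) (from s)
      where
      from : ∀ s → weight (s ∷ σ) ≡ 0 → ∃ λ τ → weight τ ≡ 0 × off ∷ τ ≡ s ∷ σ
      from off w≡0 = σ , w≡0 , refl
  signVectors-of-weight (suc m) (suc k) =
    subst (Enumerates _) count-step
      (enumerates-cong cons-split
        (enumerates-⊎ off-vs-on (cons off (suc k))
          (enumerates-⊎ pos-vs-neg (cons pos k) (cons neg k))))
    where
    Cons : Sign → ℕ → Vec Sign (suc m) → Set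
    Cons s k x = ∃ λ σ → weight σ ≡ k × s ∷ σ ≡ x

    cons : ∀ s k → Enumerates (Cons s k) (2 ^ k * (m C k))
    cons s k = enumerates-image (s ∷_) ∷-injectiveʳ (signVectors-of-weight m k)

    heads-differ : ∀ {s t x k l} → s ≢ t → Cons s k x → Cons t l x → ⊥
    heads-differ s≢t (_ , _ , e) (_ , _ , e′) = s≢t (∷-injectiveˡ (trans e (sym e′)))

    off-vs-on : ∀ x → Cons off (suc k) x → Cons pos k x ⊎ Cons neg k x → ⊥
    off-vs-on x c (inj₁ c′) = heads-differ (λ ()) c c′
    off-vs-on x c (inj₂ c′) = heads-differ (λ ()) c c′

    pos-vs-neg : ∀ x → Cons pos k x → Cons neg k x → ⊥
    pos-vs-neg x = heads-differ (λ ())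

    cons-split : ∀ x → (Cons off (suc k) x ⊎ (Cons pos k x ⊎ Cons neg k x)) ⇔ weight x ≡ suc k
    cons-split (s ∷ σ) = mk⇔ to (from s)
      where
      to : Cons off (suc k) (s ∷ σ) ⊎ (Cons pos k (s ∷ σ) ⊎ Cons neg k (s ∷ σ)) → weight (s ∷ σ) ≡ suc k
      to (inj₁ (_ , w , refl))        = w
      to (inj₂ (inj₁ (_ , w , refl))) = cong suc w
      to (inj₂ (inj₂ (_ , w , refl))) = cong suc w
      from : ∀ s → weight (s ∷ σ) ≡ suc k →
             Cons off (suc k) (s ∷ σ) ⊎ (Cons pos k (s ∷ σ) ⊎ Cons neg k (s ∷ σ))
      from off w = inj₁ (σ , w , refl)
      from pos w = inj₂ (inj₁ (σ , suc-injective w , refl))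
      from neg w = inj₂ (inj₂ (σ , suc-injective w , refl))

    count-step : 2 ^ suc k * (m C suc k) + (2 ^ k * (m C k) + 2 ^ k * (m C k)) ≡ 2 ^ suc k * (suc m C suc k)
    count-step = trans (regroup (2 ^ k) (m C k) (m C suc k))
                           (cong (2 ^ suc k *_) (nCk+nC[k+1]≡[n+1]C[k+1] m k))
      where
      regroup : ∀ a x y → 2 * a * y + (a * x + a * x) ≡ 2 * a * (x + y)
      regroup = solve-∀

module AffineIndependence where
  open import Data.Fin.Base using (Fin)
  open import Data.Fin.Properties using (_≟_)
  open import Data.Nat.Base using (ℕ)
  open import Data.Rational.Base using (ℚ; 0ℚ; 1ℚ; _+_; _*_; -_; _-_; ≢-nonZero)
  open import Data.Rational.Properties
    using (*-zeroˡ; *-identityˡ; *-identityʳ; +-inverseʳ; *-distribʳ-+; neg-distribˡ-*)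
  open import Relation.Binary.PropositionalEquality
  open import Relation.Nullary.Decidable.Core using (yes; no)
  open import Relation.Nullary.Negation using (contradiction)
  open import Defs using (Pt; Σℚ; AffIndep)
  open Rationals

  LinIndep : ∀ {n} (m : ℕ) → (Fin m → Pt n) → Set
  LinIndep m x = (α : Fin m → ℚ) → (∀ c → Σℚ m (λ a → α a * x a c) ≡ 0ℚ) → ∀ a → α a ≡ 0ℚ

  module _ {n m : ℕ} {x : Fin m → Pt n} where

    linIndep⇒affIndep : LinIndep m x → AffIndep m x
    linIndep⇒affIndep independent α _ = independent α

    coefficient-vanishes : ∀ {α : Fin m → ℚ} → (∀ c → Σℚ m (λ a → α a * x a c) ≡ 0ℚ) →
                           ∀ {a c} → x a c ≢ 0ℚ → (∀ b → b ≢ a → α b * x b c ≡ 0ℚ) → α a ≡ 0ℚ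
    coefficient-vanishes {α} dependency {a} {c} x≢0 others =
      *-cancelʳ-≡ (α a) 0ℚ (x a c) {{≢-nonZero x≢0}} (begin
        α a * x a c                ≡⟨ sym (sum-concentrated (λ b → α b * x b c) a others) ⟩
        sum {m} (λ b → α b * x b c) ≡⟨ sym (Σℚ≡sum m _) ⟩
        Σℚ m (λ b → α b * x b c)   ≡⟨ dependency c ⟩
        0ℚ                         ≡⟨ sym (*-zeroˡ (x a c)) ⟩
        0ℚ * x a c                 ∎)
      where open ≡-Reasoning

    affIndep-injective : AffIndep m x → ∀ {a b} → (∀ c → x a c ≡ x b c) → a ≡ b
    affIndep-injective independent {a} {b} xa≗xb with a ≟ b
    ... | yes a≡b = a≡b
    ... | no  a≢b = contradiction (trans (sym α[a]≡1) α[a]≡0) λ ()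
      where
      δ : Fin m → Fin m → ℚ
      δ i j with j ≟ i
      ... | yes _ = 1ℚ
      ... | no  _ = 0ℚ

      δ-self : ∀ i → δ i i ≡ 1ℚ
      δ-self i with i ≟ i
      ... | yes _   = refl
      ... | no  i≢i = contradiction refl i≢i

      δ-other : ∀ i j → j ≢ i → δ i j ≡ 0ℚ
      δ-other i j j≢i with j ≟ i
      ... | yes j≡i = contradiction j≡i j≢i
      ... | no  _   = refl

      sum-δ* : ∀ i (f : Fin m → ℚ) → sum (λ j → δ i j * f j) ≡ f i
      sum-δ* i f = begin
        sum {m} (λ j → δ i j * f j) ≡⟨ sum-concentrated _ i (λ j j≢i → trans (cong (_* f j) (δ-other i j j≢i))
                                                                              (*-zeroˡ (f j))) ⟩
        δ i i * f i                 ≡⟨ cong (_* f i) (δ-self i) ⟩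
        1ℚ * f i                    ≡⟨ *-identityˡ (f i) ⟩
        f i                         ∎
        where open ≡-Reasoning

      -- an affine dependency as soon as x a = x b
      α : Fin m → ℚ
      α j = δ a j - δ b j

      sum-α* : ∀ (f : Fin m → ℚ) → sum (λ j → α j * f j) ≡ f a - f b
      sum-α* f = begin
        sum {m} (λ j → α j * f j)       ≡⟨ sum-cong-≗ distribute ⟩
        sum (λ j → δa*f j + - δb*f j)   ≡⟨ ∑-distrib-+ δa*f (λ j → - δb*f j) ⟩
        sum δa*f + sum (λ j → - δb*f j) ≡⟨ cong₂ _+_ (sum-δ* a f) (trans (sum-neg δb*f) (cong -_ (sum-δ* b f))) ⟩
        f a - f b                       ∎
        where
        open ≡-Reasoning
        δa*f δb*f : Fin m → ℚ
        δa*f j = δ a j * f j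
        δb*f j = δ b j * f j
        distribute : ∀ j → α j * f j ≡ δa*f j + - δb*f j
        distribute j = trans (*-distribʳ-+ (f j) (δ a j) _) (cong (δa*f j +_) (sym (neg-distribˡ-* (δ b j) (f j))))

      α[a]≡1 : α a ≡ 1ℚ
      α[a]≡1 = cong₂ _-_ (δ-self a) (δ-other b a a≢b)

      α[a]≡0 : α a ≡ 0ℚ
      α[a]≡0 = independent α
        (trans (Σℚ≡sum m α) (trans (sum-cong-≗ (λ j → sym (*-identityʳ (α j))))
                                   (trans (sum-α* (λ _ → 1ℚ)) (+-inverseʳ 1ℚ))))
        (λ c → trans (Σℚ≡sum m _) (trans (sum-α* (λ j → x j c))
                                          (trans (cong (_- x b c) (xa≗xb c)) (+-inverseʳ (x b c)))))
        a

module CyclotomicPolytope (n : ℕ) where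
  open import Data.Bool.Base using (Bool; true; false)
  open import Data.Bool.Properties using (∨-zeroʳ)
  open import Data.Empty using (⊥; ⊥-elim)
  open import Data.Fin.Base using (Fin; toℕ; fromℕ; inject₁; inject≤; splitAt; _↑ˡ_; _↑ʳ_)
  open import Data.Fin.Properties
    using (_≟_; inject≤-injective; injective⇒≤; toℕ<n; toℕ-inject≤; toℕ-injective; toℕ-inject₁; toℕ-fromℕ;
           inject₁-injective; fromℕ≢inject₁; splitAt-↑ˡ; splitAt-↑ʳ;
           splitAt⁻¹-↑ˡ; splitAt⁻¹-↑ʳ)
  open import Data.Fin.Relation.Unary.Top using (view; ‵fromℕ; ‵inject₁)
  open import Data.Fin.Subset using (Subset; _∈_)
  open import Data.Fin.Subset.Properties using (⊆-antisym)
  open import Data.Nat.Base as ℕ using (ℕ; suc; _≡ᵇ_)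
  import Data.Nat.Properties as ℕ
  open import Data.Product.Base using (Σ; ∃; _×_; _,_; proj₁; proj₂)
  open import Data.Rational.Base using (ℚ; 0ℚ; 1ℚ; _+_; _*_; -_; _-_; _≤_; _<_; ≢-nonZero)
  open import Data.Rational.Properties
    using (*-zeroˡ; *-zeroʳ; *-identityʳ; neg-distribʳ-*; neg-distrib-+; +-mono-≤; ≤-<-trans; ≤-antisym; <⇒≢;
           neg-antimono-≤; module ≤-Reasoning)
  open import Data.Sum.Base using (_⊎_; inj₁; inj₂; [_,_]′)
  open import Data.Vec.Base using (Vec; []; _∷_; lookup; map; _++_; tabulate)
  open import Data.Vec.Properties
    using (lookup∘tabulate; lookup-++ˡ; lookup-++ʳ; lookup-map; []=⇒lookup; lookup⇒[]=; ++-injective;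
           ∷-injectiveˡ; ∷-injectiveʳ)
  open import Function.Base using (id; _∘_)
  open import Function.Bundles using (_⇔_; mk⇔; Equivalence)
  open import Function.Definitions using (Injective)
  open import Function.Properties.Equivalence using () renaming (sym to ⇔-sym; trans to ⇔-trans)
  open import Relation.Binary.PropositionalEquality
  open import Relation.Nullary.Decidable using (yes; no; dec-true; dec-false)
  open import Relation.Nullary.Negation using (¬_; contradiction)
  open import Defs
  open Rationals
  open SignVectors
  open AffineIndependence

  p : ℕ
  p = suc n

  last : Fin p
  last = fromℕ n

  last-or-inject₁ : ∀ (j : Fin p) → j ≡ last ⊎ ∃ λ i → j ≡ inject₁ i
  last-or-inject₁ j with view j
  ... | ‵fromℕ     = inj₁ refl
  ... | ‵inject₁ i = inj₂ (i , refl)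

  private
    ≡ᵇ-true : ∀ {a b} → a ≡ b → (a ≡ᵇ b) ≡ true
    ≡ᵇ-true {a} {b} = dec-true (a ℕ.≟ b)

    ≡ᵇ-false : ∀ {a b} → a ≢ b → (a ≡ᵇ b) ≡ false
    ≡ᵇ-false {a} {b} = dec-false (a ℕ.≟ b)

  u-one : ∀ {j c} → j ≡ inject₁ c ⊎ j ≡ last → u p j c ≡ 1ℚ
  u-one {c = c} (inj₁ refl) rewrite ≡ᵇ-true (toℕ-inject₁ c) = refl
  u-one {c = c} (inj₂ refl) rewrite ≡ᵇ-true (toℕ-fromℕ n) | ∨-zeroʳ (toℕ (fromℕ n) ≡ᵇ toℕ c) = refl

  u-zero : ∀ {j c} → j ≢ inject₁ c → j ≢ last → u p j c ≡ 0ℚ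
  u-zero {j} {c} j≢c j≢last
    rewrite ≡ᵇ-false (λ e → j≢c (toℕ-injective (trans e (sym (toℕ-inject₁ c)))))
          | ≡ᵇ-false (λ e → j≢last (toℕ-injective (trans e (sym (toℕ-fromℕ n))))) = refl

  data Vertex : Fin (p ℕ.+ p) → Set where
    +u : (j : Fin p) → Vertex (j ↑ˡ p)
    -u : (j : Fin p) → Vertex (p ↑ʳ j)

  vertex : ∀ i → Vertex i
  vertex i with splitAt p i in eq
  ... | inj₁ j = subst Vertex (splitAt⁻¹-↑ˡ eq) (+u j)
  ... | inj₂ j = subst Vertex (splitAt⁻¹-↑ʳ eq) (-u j)

  index : Fin (p ℕ.+ p) → Fin p
  index i = [ id , id ]′ (splitAt p i)

  index-↑ˡ : ∀ j → index (j ↑ˡ p) ≡ j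
  index-↑ˡ j rewrite splitAt-↑ˡ p j p = refl

  index-↑ʳ : ∀ j → index (p ↑ʳ j) ≡ j
  index-↑ʳ j rewrite splitAt-↑ʳ p p j = refl

  vert-↑ˡ : ∀ j c → vert p (j ↑ˡ p) c ≡ u p j c
  vert-↑ˡ j c rewrite splitAt-↑ˡ p j p = refl

  vert-↑ʳ : ∀ j c → vert p (p ↑ʳ j) c ≡ - u p j c
  vert-↑ʳ j c rewrite splitAt-↑ʳ p p j = refl

  vert≡±u : ∀ i c → vert p i c ≡ u p (index i) c ⊎ vert p i c ≡ - u p (index i) c
  vert≡±u i c with vertex i
  ... | +u j = inj₁ (trans (vert-↑ˡ j c) (cong (λ k → u p k c) (sym (index-↑ˡ j))))
  ... | -u j = inj₂ (trans (vert-↑ʳ j c) (cong (λ k → - u p k c) (sym (index-↑ʳ j))))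

  vert-zero : ∀ i c → index i ≢ inject₁ c → index i ≢ last → vert p i c ≡ 0ℚ
  vert-zero i c i≢c i≢last with vert≡±u i c
  ... | inj₁ eq = trans eq (u-zero i≢c i≢last)
  ... | inj₂ eq = trans eq (cong -_ (u-zero i≢c i≢last))

  vert-nonzero : ∀ i c → index i ≡ inject₁ c ⊎ index i ≡ last → vert p i c ≢ 0ℚ
  vert-nonzero i c hit with vert≡±u i c
  ... | inj₁ eq = λ v≡0 → contradiction₁ (trans (sym (u-one hit)) (trans (sym eq) v≡0))
    where
    contradiction₁ : 1ℚ ≢ 0ℚ
    contradiction₁ ()
  ... | inj₂ eq = λ v≡0 → contradiction₋₁ (trans (cong -_ (sym (u-one hit))) (trans (sym eq) v≡0))
    where
    contradiction₋₁ : - 1ℚ ≢ 0ℚ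
    contradiction₋₁ ()

  ·-congʳ : ∀ (c : Pt n) {x y : Pt n} → (∀ k → x k ≡ y k) → c · x ≡ c · y
  ·-congʳ c x≗y = trans (Σℚ≡sum n _) (trans (sum-cong-≗ (λ k → cong (c k *_) (x≗y k))) (sym (Σℚ≡sum n _)))

  ·-vert-↑ˡ : ∀ c j → c · vert p (j ↑ˡ p) ≡ c · u p j
  ·-vert-↑ˡ c j = ·-congʳ c (vert-↑ˡ j)

  ·-vert-↑ʳ : ∀ c j → c · vert p (p ↑ʳ j) ≡ - (c · u p j)
  ·-vert-↑ʳ c j = begin
    c · vert p (p ↑ʳ j)               ≡⟨ trans (·-congʳ c (vert-↑ʳ j)) (Σℚ≡sum n _) ⟩
    sum (λ k → c k * - u p j k)       ≡⟨ sum-cong-≗ (λ k → sym (neg-distribʳ-* (c k) (u p j k))) ⟩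
    sum (λ k → - (c k * u p j k))     ≡⟨ sum-neg (λ k → c k * u p j k) ⟩
    - sum (λ k → c k * u p j k)       ≡⟨ cong -_ (sym (Σℚ≡sum n _)) ⟩
    - (c · u p j)                     ∎
    where open ≡-Reasoning

  ·-u-inject₁ : ∀ c i → c · u p (inject₁ i) ≡ c i
  ·-u-inject₁ c i = begin
    c · u p (inject₁ i)                   ≡⟨ Σℚ≡sum n _ ⟩
    sum (λ k → c k * u p (inject₁ i) k)   ≡⟨ sum-concentrated _ i off-diagonal ⟩
    c i * u p (inject₁ i) i               ≡⟨ cong (c i *_) (u-one {c = i} (inj₁ refl)) ⟩
    c i * 1ℚ                              ≡⟨ *-identityʳ (c i) ⟩
    c i                                   ∎
    where
    open ≡-Reasoning
    off-diagonal : ∀ k → k ≢ i → c k * u p (inject₁ i) k ≡ 0ℚ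
    off-diagonal k k≢i = trans (cong (c k *_) (u-zero (k≢i ∘ sym ∘ inject₁-injective) (fromℕ≢inject₁ ∘ sym)))
                               (*-zeroʳ (c k))

  ·-u-last : ∀ c → c · u p last ≡ sum c
  ·-u-last c = trans (Σℚ≡sum n _)
                     (sum-cong-≗ (λ k → trans (cong (c k *_) (u-one {c = k} (inj₂ refl))) (*-identityʳ (c k))))

  ·-u-relation : ∀ c → c · u p last ≡ sum (λ i → c · u p (inject₁ i))
  ·-u-relation c = trans (·-u-last c) (sum-cong-≗ (λ i → sym (·-u-inject₁ c i)))

  isPos isNeg : Sign → Bool
  isPos pos = true
  isPos _   = false
  isNeg neg = true
  isNeg _   = false

  vertexSet : Vec Sign p → Subset (p ℕ.+ p)
  vertexSet σ = map isPos σ ++ map isNeg σ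

  +u∈vertexSet : ∀ σ j → j ↑ˡ p ∈ vertexSet σ ⇔ lookup σ j ≡ pos
  +u∈vertexSet σ j = mk⇔ (λ j∈ → isPos-true (trans (sym entry) ([]=⇒lookup j∈)))
                         (λ σj≡pos → lookup⇒[]= _ (vertexSet σ) (trans entry (cong isPos σj≡pos)))
    where
    entry : lookup (vertexSet σ) (j ↑ˡ p) ≡ isPos (lookup σ j)
    entry = trans (lookup-++ˡ (map isPos σ) (map isNeg σ) j) (lookup-map j isPos σ)
    isPos-true : ∀ {s} → isPos s ≡ true → s ≡ pos
    isPos-true {pos} _ = refl

  -u∈vertexSet : ∀ σ j → p ↑ʳ j ∈ vertexSet σ ⇔ lookup σ j ≡ neg
  -u∈vertexSet σ j = mk⇔ (λ j∈ → isNeg-true (trans (sym entry) ([]=⇒lookup j∈)))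
                         (λ σj≡neg → lookup⇒[]= _ (vertexSet σ) (trans entry (cong isNeg σj≡neg)))
    where
    entry : lookup (vertexSet σ) (p ↑ʳ j) ≡ isNeg (lookup σ j)
    entry = trans (lookup-++ʳ (map isPos σ) (map isNeg σ) j) (lookup-map j isNeg σ)
    isNeg-true : ∀ {s} → isNeg s ≡ true → s ≡ neg
    isNeg-true {neg} _ = refl

  vertexSet-injective : Injective _≡_ _≡_ vertexSet
  vertexSet-injective {σ} {τ} eq with ++-injective (map isPos σ) (map isPos τ) eq
  ... | isPos-eq , isNeg-eq = determined σ τ isPos-eq isNeg-eq
    where
    fromFlags : Bool → Bool → Sign
    fromFlags true  _     = pos
    fromFlags false true  = neg
    fromFlags false false = off
    fromFlags-flags : ∀ s → fromFlags (isPos s) (isNeg s) ≡ s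
    fromFlags-flags pos = refl
    fromFlags-flags neg = refl
    fromFlags-flags off = refl
    determined : ∀ {m} (σ τ : Vec Sign m) → map isPos σ ≡ map isPos τ → map isNeg σ ≡ map isNeg τ → σ ≡ τ
    determined []      []      _  _  = refl
    determined (s ∷ σ) (t ∷ τ) e₁ e₂ = cong₂ _∷_
      (trans (sym (fromFlags-flags s)) (trans (cong₂ fromFlags (∷-injectiveˡ e₁) (∷-injectiveˡ e₂)) (fromFlags-flags t)))
      (determined σ τ (∷-injectiveʳ e₁) (∷-injectiveʳ e₂))

  -- The vertex σ_j u_j; the junk value for off is -u_j.
  vertexAt : Sign → Fin p → Fin (p ℕ.+ p)
  vertexAt pos j = j ↑ˡ p
  vertexAt _   j = p ↑ʳ j

  index-vertexAt : ∀ s j → index (vertexAt s j) ≡ j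
  index-vertexAt pos j = index-↑ˡ j
  index-vertexAt neg j = index-↑ʳ j
  index-vertexAt off j = index-↑ʳ j

  ∈vertexSet-nonzero : ∀ σ {i} → i ∈ vertexSet σ → lookup σ (index i) ≢ off
  ∈vertexSet-nonzero σ {i} i∈ with vertex i
  ... | +u j rewrite index-↑ˡ j | Equivalence.to (+u∈vertexSet σ j) i∈ = λ ()
  ... | -u j rewrite index-↑ʳ j | Equivalence.to (-u∈vertexSet σ j) i∈ = λ ()

  ∈vertexSet-vertexAt : ∀ σ {i} → i ∈ vertexSet σ → i ≡ vertexAt (lookup σ (index i)) (index i)
  ∈vertexSet-vertexAt σ {i} i∈ with vertex i
  ... | +u j rewrite index-↑ˡ j | Equivalence.to (+u∈vertexSet σ j) i∈ = refl
  ... | -u j rewrite index-↑ʳ j | Equivalence.to (-u∈vertexSet σ j) i∈ = refl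

  ∈vertexSet-index-injective : ∀ σ {i i′} → i ∈ vertexSet σ → i′ ∈ vertexSet σ → index i ≡ index i′ → i ≡ i′
  ∈vertexSet-index-injective σ i∈ i′∈ eq =
    trans (∈vertexSet-vertexAt σ i∈) (trans (cong (λ k → vertexAt (lookup σ k) k) eq) (sym (∈vertexSet-vertexAt σ i′∈)))

  vertexAt-∈ : ∀ σ j → lookup σ j ≢ off → vertexAt (lookup σ j) j ∈ vertexSet σ
  vertexAt-∈ σ j σj≢off with lookup σ j in σj
  ... | pos = Equivalence.from (+u∈vertexSet σ j) σj
  ... | neg = Equivalence.from (-u∈vertexSet σ j) σj
  ... | off = ⊥-elim (σj≢off refl)

  -- For r = inject₁ r′, coordinate r′ sees no vertex of s but the one indexed by last;
  -- once its coefficient vanishes, coordinate c sees only the one indexed by inject₁ c.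
  distinct-indices-linIndep : ∀ {m} (s : Fin m → Fin (p ℕ.+ p)) {r} →
                              Injective _≡_ _≡_ (index ∘ s) → (∀ a → index (s a) ≢ r) → LinIndep m (vert p ∘ s)
  distinct-indices-linIndep s {r} index-injective misses-r α dependency = α≡0
    where
    α-last : ∀ a → index (s a) ≡ last → α a ≡ 0ℚ
    α-last a a↦last with last-or-inject₁ r
    ... | inj₁ r≡last        = contradiction (trans a↦last (sym r≡last)) (misses-r a)
    ... | inj₂ (r′ , r≡r′)   =
      coefficient-vanishes {x = vert p ∘ s} {α} dependency {a} {r′} (vert-nonzero (s a) r′ (inj₂ a↦last)) others
      where
      others : ∀ b → b ≢ a → α b * vert p (s b) r′ ≡ 0ℚ
      others b b≢a = trans (cong (α b *_) (vert-zero (s b) r′ (λ b↦r → misses-r b (trans b↦r (sym r≡r′)))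
                                                     (λ b↦last → b≢a (index-injective (trans b↦last (sym a↦last))))))
                           (*-zeroʳ (α b))

    α≡0 : ∀ a → α a ≡ 0ℚ
    α≡0 a with last-or-inject₁ (index (s a))
    ... | inj₁ a↦last    = α-last a a↦last
    ... | inj₂ (c , a↦c) =
      coefficient-vanishes {x = vert p ∘ s} {α} dependency {a} {c} (vert-nonzero (s a) c (inj₁ a↦c)) others
      where
      others : ∀ b → b ≢ a → α b * vert p (s b) c ≡ 0ℚ
      others b b≢a with index (s b) ≟ last
      ... | yes b↦last = trans (cong (_* vert p (s b) c) (α-last b b↦last)) (*-zeroˡ (vert p (s b) c))
      ... | no  b↛last =
        trans (cong (α b *_) (vert-zero (s b) c (λ b↦c → b≢a (index-injective (trans b↦c (sym a↦c)))) b↛last))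
              (*-zeroʳ (α b))

  affIndep-members-bound : ∀ {m} σ (s : Fin m → Fin (p ℕ.+ p)) → (∀ a → s a ∈ vertexSet σ) →
                           AffIndep m (vert p ∘ s) → m ℕ.≤ weight σ
  affIndep-members-bound {m} σ s s∈ independent = injective⇒≤ rank-injective
    where
    rank-of : Fin m → Fin (weight σ)
    rank-of a = rank σ (index (s a)) (∈vertexSet-nonzero σ (s∈ a))
    rank-injective : ∀ {a b} → rank-of a ≡ rank-of b → a ≡ b
    rank-injective {a} {b} eq = affIndep-injective independent (λ c → cong (λ i → vert p i c) s[a]≡s[b])
      where
      same-index : index (s a) ≡ index (s b)
      same-index = trans (sym (support-rank σ _ _)) (trans (cong (support σ) eq) (support-rank σ _ _))
      s[a]≡s[b] : s a ≡ s b
      s[a]≡s[b] = ∈vertexSet-index-injective σ (s∈ a) (s∈ b) same-index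

  affIndep-members : ∀ {m} σ → m ℕ.≤ weight σ → weight σ ℕ.< p →
                     Σ (Fin m → Fin (p ℕ.+ p)) λ s → (∀ a → s a ∈ vertexSet σ) × AffIndep m (vert p ∘ s)
  affIndep-members {m} σ m≤w w<p with weight<⇒off σ w<p
  ... | r , σr≡off = s , (λ a → vertexAt-∈ σ (j a) (support-nonzero σ _)) ,
                     linIndep⇒affIndep (distinct-indices-linIndep s index-injective misses-r)
    where
    j : Fin m → Fin p
    j a = support σ (inject≤ a m≤w)
    s : Fin m → Fin (p ℕ.+ p)
    s a = vertexAt (lookup σ (j a)) (j a)
    index-s : ∀ a → index (s a) ≡ j a
    index-s a = index-vertexAt (lookup σ (j a)) (j a)
    index-injective : Injective _≡_ _≡_ (index ∘ s)
    index-injective {a} {b} eq = inject≤-injective m≤w m≤w a b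
      (support-injective σ (trans (sym (index-s a)) (trans eq (index-s b))))
    misses-r : ∀ a → index (s a) ≢ r
    misses-r a a↦r = support-nonzero σ (inject≤ a m≤w)
      (trans (cong (lookup σ) (trans (sym (index-s a)) a↦r)) σr≡off)

  hasAffDim⇔weight : ∀ σ d → weight σ ℕ.< p → HasAffDim p (vertexSet σ) d ⇔ weight σ ≡ suc d
  hasAffDim⇔weight σ d w<p = mk⇔ to from
    where
    to : HasAffDim p (vertexSet σ) d → weight σ ≡ suc d
    to ((s , s∈ , independent) , no-larger) =
      ℕ.≤-antisym (ℕ.≮⇒≥ no-more-room) (affIndep-members-bound σ s s∈ independent)
      where
      no-more-room : ¬ suc d ℕ.< weight σ
      no-more-room d+1<w with affIndep-members σ d+1<w w<p
      ... | s′ , s′∈ , independent′ = no-larger s′ s′∈ independent′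
    from : weight σ ≡ suc d → HasAffDim p (vertexSet σ) d
    from w≡d+1 = affIndep-members σ (ℕ.≤-reflexive (sym w≡d+1)) w<p ,
                 λ s s∈ independent →
                   ℕ.<-irrefl refl (subst (suc (suc d) ℕ.≤_) w≡d+1 (affIndep-members-bound σ s s∈ independent))

  private
    transport-level : ∀ {x y b} {A B : Set} → y ≡ x → B ⇔ A → x ≤ b × (x ≡ b ⇔ A) → y ≤ b × (y ≡ b ⇔ B)
    transport-level refl B⇔A (x≤b , x≡b⇔A) = x≤b , ⇔-trans x≡b⇔A (⇔-sym B⇔A)

  exposes : ∀ σ c {b} → 0ℚ < b → (∀ j → Fits b (lookup σ j) (c · u p j)) →
            ∀ i → c · vert p i ≤ b × (c · vert p i ≡ b ⇔ i ∈ vertexSet σ)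
  exposes σ c 0<b fits i with vertex i
  ... | +u j = transport-level (·-vert-↑ˡ c j) (+u∈vertexSet σ j) (proj₁ (fits-level (lookup σ j) 0<b (fits j)))
  ... | -u j = transport-level (·-vert-↑ʳ c j) (-u∈vertexSet σ j) (proj₂ (fits-level (lookup σ j) 0<b (fits j)))

  exposed-isFace : ∀ σ c {b} → 0ℚ < b → (∀ j → Fits b (lookup σ j) (c · u p j)) → IsFace p (vertexSet σ)
  exposed-isFace σ c {b} 0<b fits = c , b , proj₁ ∘ exposes σ c 0<b fits , proj₂ ∘ exposes σ c 0<b fits

  sparse-isFace : ∀ σ → weight σ ℕ.+ weight σ ℕ.< p → IsFace p (vertexSet σ)
  sparse-isFace σ sparse = exposed-isFace σ c 0<Z fits
    where
    σ′ : Fin n → Sign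
    σ′ i = lookup σ (inject₁ i)
    σₗ : Sign
    σₗ = lookup σ last

    Z W E s : ℚ
    Z = sum ([_≡off] ∘ lookup σ)
    W = toℚ (weight σ)
    E = sum (⟦_⟧ ∘ σ′)
    s = E - ⟦ σₗ ⟧

    -- c · u_j = Z⟦σ_j⟧ off the zeros of σ; on the zeros the values -s (j < n) and
    -- +s (j = n) make c · 𝟏 = Σ c_i hold, and |s| ≤ W < Z keeps them below level Z.
    c : Pt n
    c i = Z * ⟦ σ′ i ⟧ + - s * [ σ′ i ≡off]

    split-bound : ∀ (f : Fin n → ℚ) y → (∀ i → f i ≤ ∣ σ′ i ∣ˢ) → y ≤ ∣ σₗ ∣ˢ → sum f + y ≤ W
    split-bound f y f≤ y≤ = begin
      sum f + y                  ≤⟨ +-mono-≤ (sum-mono-≤ f≤) y≤ ⟩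
      sum (∣_∣ˢ ∘ σ′) + ∣ σₗ ∣ˢ  ≡⟨ sym (sum-init-last (∣_∣ˢ ∘ lookup σ)) ⟩
      sum (∣_∣ˢ ∘ lookup σ)      ≡⟨ sum-∣∣ˢ σ ⟩
      W                          ∎
      where open ≤-Reasoning

    s≤W : s ≤ W
    s≤W = split-bound (⟦_⟧ ∘ σ′) (- ⟦ σₗ ⟧) (⟦⟧≤∣∣ˢ ∘ σ′) (-⟦⟧≤∣∣ˢ σₗ)

    -s≤W : - s ≤ W
    -s≤W = subst (_≤ W) (sym -s≡) (split-bound (λ i → - ⟦ σ′ i ⟧) ⟦ σₗ ⟧ (-⟦⟧≤∣∣ˢ ∘ σ′) (⟦⟧≤∣∣ˢ σₗ))
      where
      -s≡ : - s ≡ sum (λ i → - ⟦ σ′ i ⟧) + ⟦ σₗ ⟧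
      -s≡ = trans (neg-distrib-+ E (- ⟦ σₗ ⟧)) (cong₂ _+_ (sym (sum-neg (⟦_⟧ ∘ σ′))) (-‿involutive ⟦ σₗ ⟧))

    W<Z : W < Z
    W<Z = +-cancelʳ-< W Z W (begin-strict
      W + W                        ≡⟨ sym (toℚ-+ (weight σ) (weight σ)) ⟩
      toℚ (weight σ ℕ.+ weight σ)  <⟨ toℚ-mono-< sparse ⟩
      toℚ p                        ≡⟨ sym (sum-[≡off]+weight σ) ⟩
      Z + W                        ∎)
      where open ≤-Reasoning

    0<Z : 0ℚ < Z
    0<Z = ≤-<-trans (toℚ-mono-≤ {0} {weight σ} ℕ.z≤n) W<Z

    s<Z : s < Z
    s<Z = ≤-<-trans s≤W W<Z

    -s<Z : - s < Z
    -s<Z = ≤-<-trans -s≤W W<Z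

    ·-u-last-value : c · u p last ≡ Z * ⟦ σₗ ⟧ + s * [ σₗ ≡off]
    ·-u-last-value = begin
      c · u p last                                         ≡⟨ ·-u-last c ⟩
      sum c                                                ≡⟨ ∑-distrib-+ (λ i → Z * signs′ i) (λ i → - s * zeros′ i) ⟩
      sum (λ i → Z * signs′ i) + sum (λ i → - s * zeros′ i) ≡⟨ sym (cong₂ _+_ (*-distribˡ-sum Z signs′)
                                                                              (*-distribˡ-sum (- s) zeros′)) ⟩
      Z * E + - s * Z′                                     ≡⟨ subst (λ Y → Y * E + - s * Z′ ≡ Y * ⟦ σₗ ⟧ + s * zₗ)
                                                                    (sym (sum-init-last ([_≡off] ∘ lookup σ)))
                                                                    (balance Z′ zₗ E ⟦ σₗ ⟧) ⟩
      Z * ⟦ σₗ ⟧ + s * zₗ                                   ∎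
      where
      open ≡-Reasoning
      open +-*-Solver using (solve; _:+_; _:*_; :-_; _:-_; _:=_)
      signs′ zeros′ : Fin n → ℚ
      signs′ = ⟦_⟧ ∘ σ′
      zeros′ = [_≡off] ∘ σ′
      Z′ zₗ : ℚ
      Z′ = sum zeros′
      zₗ = [ σₗ ≡off]
      balance : ∀ Z′ z E l → (Z′ + z) * E + - (E - l) * Z′ ≡ (Z′ + z) * l + (E - l) * z
      balance = solve 4 (λ Z′ z E l → (Z′ :+ z) :* E :+ :- (E :- l) :* Z′ := (Z′ :+ z) :* l :+ (E :- l) :* z) refl

    fits : ∀ j → Fits Z (lookup σ j) (c · u p j)
    fits j with last-or-inject₁ j
    ... | inj₁ refl       = subst (Fits Z σₗ) (sym ·-u-last-value) (fits-perturbed s<Z -s<Z σₗ)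
    ... | inj₂ (i , refl) = subst (Fits Z (σ′ i)) (sym (·-u-inject₁ c i))
                                  (fits-perturbed -s<Z (subst (_< Z) (sym (-‿involutive s)) s<Z) (σ′ i))

  level-bounds : ∀ c {b} → (∀ i → c · vert p i ≤ b) → ∀ j → c · u p j ≤ b × - (c · u p j) ≤ b
  level-bounds c {b} below j = subst (_≤ b) (·-vert-↑ˡ c j) (below (j ↑ˡ p)) , subst (_≤ b) (·-vert-↑ʳ c j) (below (p ↑ʳ j))

  face-level-positive : ∀ {F c b} d → suc (suc d) ℕ.≤ n → (∀ i → c · vert p i ≤ b) →
                        (∀ i → (c · vert p i ≡ b) ⇔ i ∈ F) → HasAffDim p F d → 0ℚ < b
  face-level-positive {F} {c} {b} d room below on-level (_ , no-larger) = ≤∧≢⇒< 0≤b (λ 0≡b → b≢0 (sym 0≡b))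
    where
    0≤b : 0ℚ ≤ b
    0≤b = nonneg-bound (proj₁ (level-bounds c below last)) (proj₂ (level-bounds c below last))

    -- At level 0 every vertex is on the face, among them d + 2 independent ones.
    b≢0 : b ≢ 0ℚ
    b≢0 b≡0 = no-larger s (λ a → everything∈F (s a))
                          (linIndep⇒affIndep {x = vert p ∘ s} (distinct-indices-linIndep s s-index-injective s-misses-last))
      where
      vanishes : ∀ j → c · u p j ≡ 0ℚ
      vanishes j = ≤-antisym (subst (c · u p j ≤_) b≡0 (proj₁ (level-bounds c below j)))
                             (subst (0ℚ ≤_) (-‿involutive (c · u p j))
                                    (neg-antimono-≤ (subst (- (c · u p j) ≤_) b≡0 (proj₂ (level-bounds c below j)))))

      everything∈F : ∀ i → i ∈ F
      everything∈F i with vertex i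
      ... | +u j = Equivalence.to (on-level (j ↑ˡ p)) (trans (·-vert-↑ˡ c j) (trans (vanishes j) (sym b≡0)))
      ... | -u j = Equivalence.to (on-level (p ↑ʳ j)) (trans (·-vert-↑ʳ c j) (trans (cong -_ (vanishes j)) (sym b≡0)))

      d+2≤p : suc (suc d) ℕ.≤ p
      d+2≤p = ℕ.m≤n⇒m≤1+n room
      s : Fin (suc (suc d)) → Fin (p ℕ.+ p)
      s a = inject≤ a d+2≤p ↑ˡ p
      s-index-injective : Injective _≡_ _≡_ (index ∘ s)
      s-index-injective {a} {a′} eq =
        inject≤-injective d+2≤p d+2≤p a a′
          (trans (sym (index-↑ˡ (inject≤ a d+2≤p))) (trans eq (index-↑ˡ (inject≤ a′ d+2≤p))))
      s-misses-last : ∀ a → index (s a) ≢ last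
      s-misses-last a a↦last = ℕ.<⇒≢ (ℕ.<-≤-trans (toℕ<n a) room) (begin
        toℕ a                   ≡⟨ sym (toℕ-inject≤ a d+2≤p) ⟩
        toℕ (inject≤ a d+2≤p)   ≡⟨ cong toℕ (trans (sym (index-↑ˡ (inject≤ a d+2≤p))) a↦last) ⟩
        toℕ last                ≡⟨ toℕ-fromℕ n ⟩
        n                       ∎)
        where open ≡-Reasoning

  -- Via 𝟏 = Σ e_i the level condition gives ⟦σ_last⟧ = Σ_{i<n} ⟦σ_i⟧: a sign equal to
  -- a sum of an even number of signs.
  full-signs-impossible : ∀ σ c {b} h → n ≡ h ℕ.+ h → 0ℚ < b → (∀ j → Fits b (lookup σ j) (c · u p j)) →
                          (∀ j → lookup σ j ≢ off) → ⊥
  full-signs-impossible σ c {b} h n≡h+h 0<b fits nonzero = odd≢even (sum-signs-parity τ τ-nonzero)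
    where
    τ : Vec Sign n
    τ = tabulate (lookup σ ∘ inject₁)

    τ-entry : ∀ i → lookup τ i ≡ lookup σ (inject₁ i)
    τ-entry = lookup∘tabulate (lookup σ ∘ inject₁)

    τ-nonzero : ∀ i → lookup τ i ≢ off
    τ-nonzero i = subst (_≢ off) (sym (τ-entry i)) (nonzero (inject₁ i))

    value : ∀ j → c · u p j ≡ ⟦ lookup σ j ⟧ * b
    value j = fits-value (lookup σ j) (fits j) (nonzero j)

    relation : ⟦ lookup σ last ⟧ ≡ sum (⟦_⟧ ∘ lookup τ)
    relation = *-cancelʳ-≡ _ _ b {{≢-nonZero (λ b≡0 → <⇒≢ 0<b (sym b≡0))}} (begin
      ⟦ lookup σ last ⟧ * b            ≡⟨ sym (value last) ⟩
      c · u p last                     ≡⟨ ·-u-relation c ⟩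
      sum (λ i → c · u p (inject₁ i))  ≡⟨ sum-cong-≗ (λ i → trans (value (inject₁ i))
                                                                   (cong (λ s → ⟦ s ⟧ * b) (sym (τ-entry i)))) ⟩
      sum (λ i → ⟦ lookup τ i ⟧ * b)   ≡⟨ sym (*-distribʳ-sum b (⟦_⟧ ∘ lookup τ)) ⟩
      sum (⟦_⟧ ∘ lookup τ) * b         ∎)
      where open ≡-Reasoning

    odd≢even : (∃ λ q → sum (⟦_⟧ ∘ lookup τ) + (toℚ q + toℚ q) ≡ toℚ n) → ⊥
    odd≢even (q , parity) = sign+even≢even (lookup σ last) q h (nonzero last) (begin
      ⟦ lookup σ last ⟧ + (toℚ q + toℚ q)     ≡⟨ cong (_+ (toℚ q + toℚ q)) relation ⟩
      sum (⟦_⟧ ∘ lookup τ) + (toℚ q + toℚ q)  ≡⟨ parity ⟩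
      toℚ n                                   ≡⟨ cong toℚ n≡h+h ⟩
      toℚ (h ℕ.+ h)                           ≡⟨ toℚ-+ h h ⟩
      toℚ h + toℚ h                           ∎)
      where open ≡-Reasoning

  faces-are-vertexSets : ∀ {F} h d → n ≡ h ℕ.+ h → suc (suc d) ℕ.≤ n → IsFace p F → HasAffDim p F d →
                         ∃ λ σ → weight σ ℕ.< p × vertexSet σ ≡ F
  faces-are-vertexSets {F} h d n≡h+h room (c , b , below , on-level) dim = σ , weight<p , vertexSet≡F
    where
    0<b : 0ℚ < b
    0<b = face-level-positive {c = c} d room below on-level dim

    fitting : ∀ j → Σ Sign λ s → Fits b s (c · u p j)
    fitting j = fitting-sign (proj₁ (level-bounds c below j)) (proj₂ (level-bounds c below j))

    σ : Vec Sign p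
    σ = tabulate (proj₁ ∘ fitting)

    fits : ∀ j → Fits b (lookup σ j) (c · u p j)
    fits j = subst (λ s → Fits b s (c · u p j)) (sym (lookup∘tabulate (proj₁ ∘ fitting) j)) (proj₂ (fitting j))

    vertexSet≡F : vertexSet σ ≡ F
    vertexSet≡F = ⊆-antisym
      (λ {i} i∈σ → Equivalence.to (on-level i) (Equivalence.from (proj₂ (exposes σ c 0<b fits i)) i∈σ))
      (λ {i} i∈F → Equivalence.to (proj₂ (exposes σ c 0<b fits i)) (Equivalence.from (on-level i) i∈F))

    weight<p : weight σ ℕ.< p
    weight<p = ℕ.≤∧≢⇒< (weight≤length σ) λ w≡p →
      full-signs-impossible σ c h n≡h+h 0<b fits (λ j σj≡off → ℕ.<-irrefl w≡p (off⇒weight< σ j σj≡off))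

  faceOfDim⇔ : ∀ h d → n ≡ h ℕ.+ h → suc d ℕ.+ suc d ℕ.≤ n → ∀ F →
               (∃ λ σ → weight σ ≡ suc d × vertexSet σ ≡ F) ⇔ IsFaceOfDim p d F
  faceOfDim⇔ h d n≡h+h small F = mk⇔ to from
    where
    room : suc (suc d) ℕ.≤ n
    room = ℕ.≤-trans (ℕ.s≤s (ℕ.m≤n+m (suc d) d)) small

    to : ∀ {F} → (∃ λ σ → weight σ ≡ suc d × vertexSet σ ≡ F) → IsFaceOfDim p d F
    to (σ , w≡d+1 , refl) = sparse-isFace σ sparse , Equivalence.from (hasAffDim⇔weight σ d w<p) w≡d+1
      where
      sparse : weight σ ℕ.+ weight σ ℕ.< p
      sparse = ℕ.s≤s (subst (λ w → w ℕ.+ w ℕ.≤ n) (sym w≡d+1) small)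
      w<p : weight σ ℕ.< p
      w<p = ℕ.≤-<-trans (ℕ.m≤m+n (weight σ) (weight σ)) sparse

    from : ∀ {F} → IsFaceOfDim p d F → ∃ λ σ → weight σ ≡ suc d × vertexSet σ ≡ F
    from {F} (face , dim) = characterise (faces-are-vertexSets {F} h d n≡h+h room face dim)
      where
      characterise : (∃ λ σ → weight σ ℕ.< p × vertexSet σ ≡ F) → ∃ λ σ → weight σ ≡ suc d × vertexSet σ ≡ F
      characterise (σ , w<p , σ≡F) =
        σ , Equivalence.to (hasAffDim⇔weight σ d w<p) (subst (λ G → HasAffDim p G d) (sym σ≡F) dim) , σ≡F

open import Defs
open import Data.Nat using (ℕ; _≤_; _∸_; _^_; _*_; suc)
open import Data.Nat.DivMod using (_/_)
open import Data.Nat.Primality using (Prime)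
open import Data.Nat.Combinatorics using (_C_)
open import Relation.Binary.PropositionalEquality using (_≢_)

open import Data.Nat.Base using (zero; _+_)
open import Data.Nat.DivMod using (m*n/n≡m)
open import Data.Nat.Divisibility using (divides)
open import Data.Nat.Primality using (prime⇒irreducible)
open import Data.Nat.Properties using (+-suc; +-mono-≤; *-comm; +-identityʳ)
open import Data.Product.Base using (∃; _,_)
open import Data.Sum.Base using (_⊎_; inj₁; inj₂)
open import Relation.Binary.PropositionalEquality using (_≡_; refl; sym; trans; cong; subst)
open import Relation.Nullary.Negation using (contradiction)
open Enumerations using (enumerates-cong; enumerates-image; signVectors-of-weight)

even-or-odd : ∀ m → (∃ λ h → m ≡ h + h) ⊎ (∃ λ h → m ≡ suc (h + h))
even-or-odd zero    = inj₁ (0 , refl)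
even-or-odd (suc m) with even-or-odd m
... | inj₁ (h , refl) = inj₂ (h , refl)
... | inj₂ (h , refl) = inj₁ (suc h , cong suc (sym (+-suc h h)))

double≡*2 : ∀ h → h + h ≡ h * 2
double≡*2 h = trans (cong (h +_) (sym (+-identityʳ h))) (*-comm 2 h)

odd-prime : ∀ {p} → Prime p → p ≢ 2 → ∃ λ h → p ≡ suc (h + h)
odd-prime {p} p-prime p≢2 with even-or-odd p
... | inj₂ odd = odd
... | inj₁ (h , p≡h+h) with prime⇒irreducible p-prime (divides h (trans p≡h+h (double≡*2 h)))
...   | inj₁ ()
...   | inj₂ 2≡p = contradiction (sym 2≡p) p≢2

corollary5p2 : (p : ℕ) → Prime p → p ≢ 2 → (k : ℕ) → 1 ≤ k → k ≤ (p ∸ 1) / 2 →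
    CountIs (IsFaceOfDim p (k ∸ 1)) (2 ^ k * (p C k))
corollary5p2 p p-prime p≢2 zero    ()
corollary5p2 p p-prime p≢2 (suc d) _ k≤ with odd-prime p-prime p≢2
... | h , refl =
  enumerates-cong (faceOfDim⇔ h d refl (+-mono-≤ k≤h k≤h))
    (enumerates-image vertexSet vertexSet-injective (signVectors-of-weight (suc (h + h)) (suc d)))
  where
  open CyclotomicPolytope (h + h)
  k≤h : suc d ≤ h
  k≤h = subst (suc d ≤_) (trans (cong (_/ 2) (double≡*2 h)) (m*n/n≡m h 2)) k≤
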